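{- Let $G$ be an undirected graph on $n$ vertices with maximum degree at most $d$, and let $N$ be any integer with $N\ge n+d+1$ and $Nd$ even. Then there is a $d$-regular graph on $N$ vertices that contains $G$ as a subgraph. -}

module Defs where

open import Data.Nat using (ℕ; _≤_)
open import Data.Bool using (Bool; true; false)
open import Data.Fin using (Fin)
open import Data.List using (map; allFin)
open import Data.Nat.ListAction using (sum)
open import Relation.Binary.PropositionalEquality using (_≡_)
open import Function.Definitions using (Injective)

record Graph (n : ℕ) : Set where
  field
    adj       : Fin n → Fin n → Bool
    symmetric : ∀ u v → adj u v ≡ adj v u
    irreflexive : ∀ v → adj v v ≡ false

open Graph public

b2n : Bool → ℕ
b2n true  = 1
b2n false = 0

degree : ∀ {n} → Graph n → Fin n → ℕ
degree {n} G v = sum (map (λ u → b2n (adj G v u)) (allFin n))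

MaxDegreeAtMost : ∀ {n} → Graph n → ℕ → Set
MaxDegreeAtMost G d = ∀ v → degree G v ≤ d

Regular : ∀ {n} → Graph n → ℕ → Set
Regular G d = ∀ v → degree G v ≡ d

record SubgraphOf {n N : ℕ} (G : Graph n) (H : Graph N) : Set where
  field
    embed      : Fin n → Fin N
    injective  : Injective _≡_ _≡_ embed
    preserves  : ∀ u v → adj G u v ≡ true → adj H (embed u) (embed v) ≡ true

-- Start from G together with M = N − n ≥ d + 1 isolated new vertices and raise
-- the degree sum by two at a time, keeping every degree at most d and every edge
-- of G. Let u have degree < d. If u has a non-neighbour x ≠ u of degree < d, add
-- the edge ux. Otherwise every other deficient vertex is adjacent to u; take
-- v = u if u misses at least two edges, and else another deficient vertex v,
-- which exists because the degree sum Nd is even. As u has fewer than M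
-- neighbours, some new vertex w ∉ N[u] exists, and w has degree d. Since w has
-- more neighbours than v, some neighbour y of w lies outside N[v]. Replacing
-- the edge wy by wu and vy keeps G (w is new), the degrees of w and y, and
-- raises the degrees of u and v by one each.
module Submission where

open import Data.Nat using (ℕ; zero; suc; _+_; _*_; _≤_; _<_; z≤n; s≤s; z<s; _<?_)
open import Data.Nat.Properties hiding (_≟_)
open import Data.Nat.Divisibility using (_∣_; divides; ∣m∣n⇒∣m+n; ∣m+n∣m⇒∣n; ∣1⇒≡1)
open import Data.Nat.Tactic.RingSolver using (solve-∀)
open import Data.Bool using (Bool; true; false; _∧_; _∨_; if_then_else_)
open import Data.Bool.Properties as Bool using (∧-comm; ∨-comm; ∨-identityʳ)
open import Data.Empty using (⊥; ⊥-elim)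
open import Data.Fin using (Fin; zero; suc; _↑ˡ_; _↑ʳ_; splitAt; join)
open import Data.Fin.Properties
  using (_≟_; any?; ↑ˡ-injective; splitAt-↑ˡ; splitAt-↑ʳ; join-splitAt)
open import Data.List using (tabulate)
open import Data.List.Properties using (map-tabulate)
open import Data.Nat.ListAction using (sum)
open import Data.Product using (Σ-syntax; ∃-syntax; _×_; _,_)
open import Data.Sum using (_⊎_; inj₁; inj₂)
open import Function using (_∘_)
open import Relation.Binary.PropositionalEquality
open import Relation.Nullary using (yes; no; does; ¬_; ¬?)
open import Relation.Nullary.Decidable using (_×-dec_; dec-true; dec-false)
open import Algebra.Properties.Semiring.Sum +-*-semiring renaming (sum to ∑)
open import Defs

∑-const : ∀ k c → ∑[ i < k ] c ≡ k * c
∑-const zero    c = refl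
∑-const (suc k) c = cong (c +_) (∑-const k c)

∑-mono-≤ : ∀ {k} {f g : Fin k → ℕ} → (∀ i → f i ≤ g i) → ∑ f ≤ ∑ g
∑-mono-≤ {zero}  f≤g = z≤n
∑-mono-≤ {suc k} f≤g = +-mono-≤ (f≤g zero) (∑-mono-≤ (f≤g ∘ suc))

∑-<⇒∃< : ∀ {k} {f g : Fin k → ℕ} → ∑ f < ∑ g → ∃[ i ] f i < g i
∑-<⇒∃< {f = f} {g} ∑f<∑g with any? (λ i → f i <? g i)
... | yes found = found
... | no none   = ⊥-elim (<⇒≱ ∑f<∑g (∑-mono-≤ (λ i → ≮⇒≥ (λ f<g → none (i , f<g)))))

∑-↑ : ∀ m {n} (f : Fin (m + n) → ℕ) →
      ∑ f ≡ ∑[ i < m ] f (i ↑ˡ n) + ∑[ j < n ] f (m ↑ʳ j)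
∑-↑ zero    f = refl
∑-↑ (suc m) f = trans (cong (f zero +_) (∑-↑ m (f ∘ suc))) (sym (+-assoc (f zero) _ _))

∑-tabulate : ∀ {k} (f : Fin k → ℕ) → sum (tabulate f) ≡ ∑ f
∑-tabulate {zero}  f = refl
∑-tabulate {suc k} f = cong (f zero +_) (∑-tabulate (f ∘ suc))

-- Row 0 and column 0 both sum to the same R, and the rest is the k × k case.
symmetric-∑∑-even : ∀ {k} (a : Fin k → Fin k → ℕ) → (∀ x z → a x z ≡ a z x) → (∀ x → a x x ≡ 0) →
                    2 ∣ ∑[ x < k ] ∑[ z < k ] a x z
symmetric-∑∑-even {zero}  a a-sym a-diag = divides 0 refl
symmetric-∑∑-even {suc k} a a-sym a-diag =
  subst (2 ∣_) (sym split) (∣m∣n⇒∣m+n (divides R (double R))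
    (symmetric-∑∑-even (λ x z → a (suc x) (suc z)) (λ x z → a-sym (suc x) (suc z)) (a-diag ∘ suc)))
  where
  open ≡-Reasoning
  R S : ℕ
  R = ∑[ z < k ] a zero (suc z)
  S = ∑[ x < k ] ∑[ z < k ] a (suc x) (suc z)
  double : ∀ r → r + r ≡ r * 2
  double = solve-∀
  split : ∑[ x < suc k ] ∑[ z < suc k ] a x z ≡ (R + R) + S
  split = begin
    a zero zero + R + ∑[ x < k ] (a (suc x) zero + ∑[ z < k ] a (suc x) (suc z))
      ≡⟨ cong₂ (λ d t → d + R + t) (a-diag zero)
               (∑-distrib-+ (λ x → a (suc x) zero) (λ x → ∑[ z < k ] a (suc x) (suc z))) ⟩
    R + (∑[ x < k ] a (suc x) zero + S)
      ≡⟨ cong (λ t → R + (t + S)) (sum-cong-≗ (λ x → a-sym (suc x) zero)) ⟩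
    R + (R + S)
      ≡⟨ sym (+-assoc R R S) ⟩
    R + R + S ∎

b2n≡0⇒≡false : ∀ {b} → b2n b ≡ 0 → b ≡ false
b2n≡0⇒≡false {false} _ = refl

true≢false : true ≢ false
true≢false ()

<b2n⇒ : ∀ {m b} → m < b2n b → m ≡ 0 × b ≡ true
<b2n⇒ {b = true} (s≤s z≤n) = refl , refl

δ : ∀ {k} → Fin k → Fin k → ℕ
δ p x = b2n (does (p ≟ x))

δ-refl : ∀ {k} (p : Fin k) → δ p p ≡ 1
δ-refl p = cong b2n (dec-true (p ≟ p) refl)

δ-≢ : ∀ {k} {p x : Fin k} → p ≢ x → δ p x ≡ 0
δ-≢ {p = p} {x} p≢x = cong b2n (dec-false (p ≟ x) p≢x)

δ≡0⇒≢ : ∀ {k} {p x : Fin k} → δ p x ≡ 0 → p ≢ x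
δ≡0⇒≢ {p = p} δ≡0 refl = 1+n≢0 (trans (sym (δ-refl p)) δ≡0)

∑-δ : ∀ {k} (p : Fin k) → ∑[ x < k ] δ p x ≡ 1
∑-δ {suc k} zero    = cong suc (sum-replicate-zero k)
∑-δ {suc k} (suc p) = ∑-δ p

∑-+δ : ∀ {k} (f : Fin k → ℕ) (p : Fin k) → ∑[ x < k ] (f x + δ p x) ≡ ∑ f + 1
∑-+δ f p = trans (∑-distrib-+ f (δ p)) (cong (∑ f +_) (∑-δ p))

+δ-≤ : ∀ {k d} {f : Fin k → ℕ} {p : Fin k} → (∀ x → f x ≤ d) → f p < d → ∀ x → f x + δ p x ≤ d
+δ-≤ {d = d} {f} {p} f≤d fp<d x with p ≟ x
... | yes refl = subst (_≤ d) (+-comm 1 (f p)) fp<d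
... | no  _    = subst (_≤ d) (sym (+-identityʳ (f x))) (f≤d x)

module _ {k : ℕ} where

  degree≡∑ : (F : Graph k) (x : Fin k) → degree F x ≡ ∑[ z < k ] b2n (adj F x z)
  degree≡∑ F x = trans (cong sum (map-tabulate (λ z → z) (λ z → b2n (adj F x z))))
                       (∑-tabulate (λ z → b2n (adj F x z)))

  handshake : (F : Graph k) → 2 ∣ ∑[ x < k ] degree F x
  handshake F = subst (2 ∣_) (sym (sum-cong-≗ (degree≡∑ F)))
    (symmetric-∑∑-even (λ x z → b2n (adj F x z))
      (λ x z → cong b2n (symmetric F x z)) (λ x → cong b2n (irreflexive F x)))

  closedNbhd : Graph k → Fin k → Fin k → ℕ
  closedNbhd F u x = b2n (adj F u x) + δ u x

  ∑-row+δ : (F : Graph k) (u p : Fin k) → ∑[ x < k ] (b2n (adj F u x) + δ p x) ≡ degree F u + 1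
  ∑-row+δ F u p = trans (∑-+δ (λ x → b2n (adj F u x)) p) (cong (_+ 1) (sym (degree≡∑ F u)))

  closedNbhd≡0 : (F : Graph k) {u x : Fin k} → closedNbhd F u x ≡ 0 → u ≢ x × adj F u x ≡ false
  closedNbhd≡0 F {u} {x} N≡0 =
    δ≡0⇒≢ (m+n≡0⇒n≡0 (b2n (adj F u x)) N≡0) , b2n≡0⇒≡false (m+n≡0⇒m≡0 _ N≡0)

  adj⇒≢ : (F : Graph k) {x z : Fin k} → adj F x z ≡ true → x ≢ z
  adj⇒≢ F {x} xz refl with trans (sym xz) (irreflexive F x)
  ... | ()

  nonNeighbour≢neighbour : (F : Graph k) {u v w : Fin k} →
                           v ≡ u ⊎ adj F u v ≡ true → u ≢ w → adj F u w ≡ false → w ≢ v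
  nonNeighbour≢neighbour F (inj₁ refl) u≢w _   refl = u≢w refl
  nonNeighbour≢neighbour F (inj₂ uv)   _   ¬uw refl = true≢false (trans (sym uv) ¬uw)

  closedNbhd-sym : (F : Graph k) {u v : Fin k} → v ≡ u ⊎ adj F u v ≡ true → 1 ≤ closedNbhd F v u
  closedNbhd-sym F {u} (inj₁ refl) =
    subst (λ t → 1 ≤ b2n (adj F u u) + t) (sym (δ-refl u)) (m≤n+m 1 _)
  closedNbhd-sym F {u} {v} (inj₂ uv) rewrite symmetric F v u | uv = s≤s z≤n

  isPair : Fin k → Fin k → Fin k → Fin k → Bool
  isPair p q x z = (does (p ≟ x) ∧ does (q ≟ z)) ∨ (does (q ≟ x) ∧ does (p ≟ z))

  isPair-sym : ∀ p q x z → isPair p q x z ≡ isPair p q z x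
  isPair-sym p q x z = trans (∨-comm (does (p ≟ x) ∧ does (q ≟ z)) (does (q ≟ x) ∧ does (p ≟ z)))
    (cong₂ _∨_ (∧-comm (does (q ≟ x)) (does (p ≟ z))) (∧-comm (does (p ≟ x)) (does (q ≟ z))))

  isPair-irrefl : ∀ {p q} → p ≢ q → ∀ x → isPair p q x x ≡ false
  isPair-irrefl {p} {q} p≢q x with p ≟ x | q ≟ x
  ... | yes refl | yes q≡p = ⊥-elim (p≢q (sym q≡p))
  ... | yes _    | no  _   = refl
  ... | no  _    | yes _   = refl
  ... | no  _    | no  _   = refl

  ≟∧≟⇒ : ∀ {a b c e : Fin k} → does (a ≟ b) ∧ does (c ≟ e) ≡ true → a ≡ b × c ≡ e
  ≟∧≟⇒ {a} {b} {c} {e} t with a ≟ b | c ≟ e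
  ... | yes a≡b | yes c≡e = a≡b , c≡e

  isPair⇒ : ∀ {p q x z} → isPair p q x z ≡ true → (p ≡ x × q ≡ z) ⊎ (q ≡ x × p ≡ z)
  isPair⇒ {p} {q} {x} {z} t with p ≟ x | q ≟ z
  ... | yes p≡x | yes q≡z = inj₁ (p≡x , q≡z)
  ... | yes _   | no  _   = inj₂ (≟∧≟⇒ t)
  ... | no  _   | _       = inj₂ (≟∧≟⇒ t)

  setEdge : (F : Graph k) (p q : Fin k) → p ≢ q → Bool → Graph k
  adj         (setEdge F p q p≢q b) x z = if isPair p q x z then b else adj F x z
  symmetric   (setEdge F p q p≢q b) x z rewrite isPair-sym p q x z | symmetric F x z = refl
  irreflexive (setEdge F p q p≢q b) x rewrite isPair-irrefl p≢q x = irreflexive F x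

  isPair-adj : (F : Graph k) {p q x z : Fin k} → isPair p q x z ≡ true → adj F x z ≡ adj F p q
  isPair-adj F {p} {q} {x} {z} t with isPair⇒ {p} {q} {x} {z} t
  ... | inj₁ (refl , refl) = refl
  ... | inj₂ (refl , refl) = symmetric F q p

  ∑-isPair : ∀ {p q} → p ≢ q → ∀ x → ∑[ z < k ] b2n (isPair p q x z) ≡ δ p x + δ q x
  ∑-isPair {p} {q} p≢q x with p ≟ x | q ≟ x
  ... | yes refl | yes q≡p = ⊥-elim (p≢q (sym q≡p))
  ... | yes _    | no  _   =
    trans (sum-cong-≗ (λ z → cong b2n (∨-identityʳ (does (q ≟ z))))) (∑-δ q)
  ... | no  _    | yes _   = ∑-δ p
  ... | no  _    | no  _   = sum-replicate-zero k

  -- The pair {p, q} occurs only in the rows of p and q; both sides are shifted so that no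
  -- subtraction occurs.
  degree-setEdge : (F : Graph k) {p q : Fin k} (p≢q : p ≢ q) (b : Bool) (x : Fin k) →
    degree (setEdge F p q p≢q b) x + (δ p x + δ q x) * b2n (adj F p q) ≡
    degree F x + (δ p x + δ q x) * b2n b
  degree-setEdge F {p} {q} p≢q b x = begin
    degree F′ x + (δ p x + δ q x) * b2n (adj F p q)
      ≡⟨ cong₂ (λ d s → d + s * b2n (adj F p q)) (degree≡∑ F′ x) (sym (∑-isPair p≢q x)) ⟩
    ∑ (row F′) + ∑ pair * b2n (adj F p q)
      ≡⟨ cong (∑ (row F′) +_) (*-distribʳ-sum (b2n (adj F p q)) pair) ⟩
    ∑ (row F′) + ∑[ z < k ] (pair z * b2n (adj F p q))
      ≡⟨ sym (∑-distrib-+ (row F′) _) ⟩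
    ∑[ z < k ] (row F′ z + pair z * b2n (adj F p q))
      ≡⟨ sum-cong-≗ pointwise ⟩
    ∑[ z < k ] (row F z + pair z * b2n b)
      ≡⟨ ∑-distrib-+ (row F) _ ⟩
    ∑ (row F) + ∑[ z < k ] (pair z * b2n b)
      ≡⟨ cong₂ _+_ (sym (degree≡∑ F x)) (sym (*-distribʳ-sum (b2n b) pair)) ⟩
    degree F x + ∑ pair * b2n b
      ≡⟨ cong (λ s → degree F x + s * b2n b) (∑-isPair p≢q x) ⟩
    degree F x + (δ p x + δ q x) * b2n b ∎
    where
    open ≡-Reasoning
    F′ = setEdge F p q p≢q b
    row : Graph k → Fin k → ℕ
    row H z = b2n (adj H x z)
    pair : Fin k → ℕ
    pair z = b2n (isPair p q x z)
    pointwise : ∀ z → row F′ z + pair z * b2n (adj F p q) ≡ row F z + pair z * b2n b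
    pointwise z with isPair p q x z in t
    ... | true  = trans (+-comm (b2n b) _)
      (cong₂ _+_ (trans (+-identityʳ _) (cong b2n (sym (isPair-adj F t)))) (sym (+-identityʳ (b2n b))))
    ... | false = refl

  degree-addEdge : (F : Graph k) {p q : Fin k} (p≢q : p ≢ q) → adj F p q ≡ false → ∀ x →
                   degree (setEdge F p q p≢q true) x ≡ degree F x + δ p x + δ q x
  degree-addEdge F {p} {q} p≢q ¬pq x = begin
    degree F′ x                        ≡⟨ +-identityʳ _ ⟨
    degree F′ x + 0                    ≡⟨ cong (degree F′ x +_) (*-zeroʳ s) ⟨
    degree F′ x + s * b2n false        ≡⟨ cong (λ a → degree F′ x + s * b2n a) ¬pq ⟨
    degree F′ x + s * b2n (adj F p q)  ≡⟨ degree-setEdge F p≢q true x ⟩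
    degree F x + s * 1                 ≡⟨ cong (degree F x +_) (*-identityʳ s) ⟩
    degree F x + s                     ≡⟨ +-assoc (degree F x) (δ p x) (δ q x) ⟨
    degree F x + δ p x + δ q x         ∎
    where
    open ≡-Reasoning
    F′ = setEdge F p q p≢q true
    s = δ p x + δ q x

  degree-removeEdge : (F : Graph k) {p q : Fin k} (p≢q : p ≢ q) → adj F p q ≡ true → ∀ x →
                      degree (setEdge F p q p≢q false) x + δ p x + δ q x ≡ degree F x
  degree-removeEdge F {p} {q} p≢q pq x = begin
    degree F′ x + δ p x + δ q x        ≡⟨ +-assoc (degree F′ x) (δ p x) (δ q x) ⟩
    degree F′ x + s                    ≡⟨ cong (degree F′ x +_) (*-identityʳ s) ⟨
    degree F′ x + s * b2n true         ≡⟨ cong (λ a → degree F′ x + s * b2n a) pq ⟨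
    degree F′ x + s * b2n (adj F p q)  ≡⟨ degree-setEdge F p≢q false x ⟩
    degree F x + s * 0                 ≡⟨ cong (degree F x +_) (*-zeroʳ s) ⟩
    degree F x + 0                     ≡⟨ +-identityʳ _ ⟩
    degree F x                         ∎
    where
    open ≡-Reasoning
    F′ = setEdge F p q p≢q false
    s = δ p x + δ q x

  setEdge-true-⊇ : (F : Graph k) {p q : Fin k} (p≢q : p ≢ q) {x z : Fin k} →
                   adj F x z ≡ true → adj (setEdge F p q p≢q true) x z ≡ true
  setEdge-true-⊇ F {p} {q} p≢q {x} {z} xz with isPair p q x z
  ... | true  = refl
  ... | false = xz

  setEdge-false-⊆ : (F : Graph k) {p q : Fin k} (p≢q : p ≢ q) {x z : Fin k} →
                    adj F x z ≡ false → adj (setEdge F p q p≢q false) x z ≡ false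
  setEdge-false-⊆ F {p} {q} p≢q {x} {z} ¬xz with isPair p q x z
  ... | true  = refl
  ... | false = ¬xz

  setEdge-avoiding : (F : Graph k) {p q : Fin k} (p≢q : p ≢ q) (b : Bool) {x z : Fin k} →
                     p ≢ x → p ≢ z → adj (setEdge F p q p≢q b) x z ≡ adj F x z
  setEdge-avoiding F {p} {q} p≢q b {x} {z} p≢x p≢z with isPair p q x z in t
  ... | false = refl
  ... | true with isPair⇒ {p} {q} {x} {z} t
  ...   | inj₁ (p≡x , _) = ⊥-elim (p≢x p≡x)
  ...   | inj₂ (_ , p≡z) = ⊥-elim (p≢z p≡z)

  switch : (F : Graph k) {u v w y : Fin k} → w ≢ y → w ≢ u → v ≢ y → Graph k
  switch F {u} {v} {w} {y} w≢y w≢u v≢y =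
    setEdge (setEdge (setEdge F w y w≢y false) w u w≢u true) v y v≢y true

  switch-⊇ : (F : Graph k) {u v w y : Fin k} (w≢y : w ≢ y) (w≢u : w ≢ u) (v≢y : v ≢ y) {x z : Fin k} →
             w ≢ x → w ≢ z → adj F x z ≡ true → adj (switch F w≢y w≢u v≢y) x z ≡ true
  switch-⊇ F w≢y w≢u v≢y w≢x w≢z xz =
    setEdge-true-⊇ F₂ v≢y (setEdge-true-⊇ F₁ w≢u (trans (setEdge-avoiding F w≢y false w≢x w≢z) xz))
    where
    F₁ = setEdge F _ _ w≢y false
    F₂ = setEdge F₁ _ _ w≢u true

  degree-switch : (F : Graph k) {u v w y : Fin k} (w≢y : w ≢ y) (w≢u : w ≢ u) (v≢y : v ≢ y) →
                  w ≢ v →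
                  adj F w y ≡ true → adj F w u ≡ false → adj F v y ≡ false →
                  ∀ x → degree (switch F w≢y w≢u v≢y) x ≡ degree F x + δ u x + δ v x
  degree-switch F {u} {v} {w} {y} w≢y w≢u v≢y w≢v wy ¬wu ¬vy x = begin
    degree F₃ x
      ≡⟨ degree-addEdge F₂ v≢y ¬vy₂ x ⟩
    degree F₂ x + δ v x + δ y x
      ≡⟨ cong (λ t → t + δ v x + δ y x) (degree-addEdge F₁ w≢u ¬wu₁ x) ⟩
    degree F₁ x + δ w x + δ u x + δ v x + δ y x
      ≡⟨ rearrange (degree F₁ x) (δ w x) (δ u x) (δ v x) (δ y x) ⟩
    degree F₁ x + δ w x + δ y x + δ u x + δ v x
      ≡⟨ cong (λ t → t + δ u x + δ v x) (degree-removeEdge F w≢y wy x) ⟩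
    degree F x + δ u x + δ v x ∎
    where
    open ≡-Reasoning
    F₁ = setEdge F w y w≢y false
    F₂ = setEdge F₁ w u w≢u true
    F₃ = switch F w≢y w≢u v≢y
    ¬wu₁ : adj F₁ w u ≡ false
    ¬wu₁ = setEdge-false-⊆ F w≢y ¬wu
    ¬vy₂ : adj F₂ v y ≡ false
    ¬vy₂ = trans (setEdge-avoiding F₁ w≢u true w≢v w≢y) (setEdge-false-⊆ F w≢y ¬vy)
    rearrange : ∀ a b c e f → a + b + c + e + f ≡ a + b + f + c + e
    rearrange = solve-∀

  -- N(w) ∪ {u} has more elements than N[v] ∋ u, so some neighbour of w lies outside N[v].
  privateNeighbour : (F : Graph k) {u v w : Fin k} →
                     v ≡ u ⊎ adj F u v ≡ true → adj F u w ≡ false → degree F v < degree F w →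
                     ∃[ y ] (adj F w y ≡ true × v ≢ y × adj F v y ≡ false)
  privateNeighbour F {u} {v} {w} v∈N[u] ¬uw v<w
    with ∑-<⇒∃< {f = closedNbhd F v} {g = λ x → b2n (adj F w x) + δ u x} fewer
    where
    fewer : ∑ (closedNbhd F v) < ∑[ x < k ] (b2n (adj F w x) + δ u x)
    fewer = begin-strict
      ∑ (closedNbhd F v)                      ≡⟨ ∑-row+δ F v v ⟩
      degree F v + 1                          <⟨ +-monoˡ-< 1 v<w ⟩
      degree F w + 1                          ≡⟨ ∑-row+δ F w u ⟨
      ∑[ x < k ] (b2n (adj F w x) + δ u x)    ∎
      where open ≤-Reasoning
  ... | y , N<f with u ≟ y
  ...   | yes refl = ⊥-elim (<⇒≱ N<f (begin
      b2n (adj F w u) + 1      ≡⟨ cong (λ b → b2n b + 1) (trans (symmetric F w u) ¬uw) ⟩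
      1                        ≤⟨ closedNbhd-sym F v∈N[u] ⟩
      closedNbhd F v u         ∎))
    where open ≤-Reasoning
  ...   | no  u≢y with <b2n⇒ (subst (closedNbhd F v y <_) (+-identityʳ _) N<f)
  ...     | N≡0 , wy = y , wy , closedNbhd≡0 F N≡0

-- N[u] has fewer than n elements, so it misses one of the n vertices m ↑ʳ j.
freshNonNeighbour : ∀ {m n} (F : Graph (m + n)) (u : Fin (m + n)) → degree F u + 1 < n →
                    ∃[ j ] (u ≢ m ↑ʳ j × adj F u (m ↑ʳ j) ≡ false)
freshNonNeighbour {m} {n} F u small
  with ∑-<⇒∃< {f = closedNbhd F u ∘ (m ↑ʳ_)} {g = λ _ → 1} fewer
  where
  fewer : ∑[ j < n ] closedNbhd F u (m ↑ʳ j) < ∑[ j < n ] 1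
  fewer = begin-strict
    ∑[ j < n ] closedNbhd F u (m ↑ʳ j)  ≤⟨ m≤n+m _ _ ⟩
    ∑[ i < m ] closedNbhd F u (i ↑ˡ n) + ∑[ j < n ] closedNbhd F u (m ↑ʳ j)
                                        ≡⟨ ∑-↑ m (closedNbhd F u) ⟨
    ∑ (closedNbhd F u)                  ≡⟨ ∑-row+δ F u u ⟩
    degree F u + 1                      <⟨ small ⟩
    n                                   ≡⟨ trans (∑-const n 1) (*-identityʳ n) ⟨
    ∑[ j < n ] 1                        ∎
    where open ≤-Reasoning
... | j , N<1 = j , closedNbhd≡0 F (n<1⇒n≡0 N<1)

↑ʳ≢↑ˡ : ∀ {m n} (j : Fin n) (i : Fin m) → m ↑ʳ j ≢ i ↑ˡ n
↑ʳ≢↑ˡ {m} {n} j i eq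
  with trans (sym (splitAt-↑ʳ m n j)) (trans (cong (splitAt m) eq) (splitAt-↑ˡ m i n))
... | ()

padAdj : ∀ {n M} → Graph n → Fin n ⊎ Fin M → Fin n ⊎ Fin M → Bool
padAdj G (inj₁ a) (inj₁ b) = adj G a b
padAdj G _        _        = false

padded : ∀ {n} → Graph n → ∀ M → Graph (n + M)
adj (padded {n} G M) x z = padAdj G (splitAt n x) (splitAt n z)
symmetric (padded {n} G M) x z with splitAt n x | splitAt n z
... | inj₁ a | inj₁ b = symmetric G a b
... | inj₁ _ | inj₂ _ = refl
... | inj₂ _ | inj₁ _ = refl
... | inj₂ _ | inj₂ _ = refl
irreflexive (padded {n} G M) x with splitAt n x
... | inj₁ a = irreflexive G a
... | inj₂ _ = refl

padded-↑ˡ : ∀ {n} (G : Graph n) M (a b : Fin n) → adj (padded G M) (a ↑ˡ M) (b ↑ˡ M) ≡ adj G a b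
padded-↑ˡ {n} G M a b rewrite splitAt-↑ˡ n a M | splitAt-↑ˡ n b M = refl

degree-padded-↑ˡ : ∀ {n} (G : Graph n) M (a : Fin n) → degree (padded G M) (a ↑ˡ M) ≡ degree G a
degree-padded-↑ˡ {n} G M a = begin
  degree P (a ↑ˡ M)                                       ≡⟨ degree≡∑ P (a ↑ˡ M) ⟩
  ∑ (row (a ↑ˡ M))                                        ≡⟨ ∑-↑ n (row (a ↑ˡ M)) ⟩
  ∑[ b < n ] row (a ↑ˡ M) (b ↑ˡ M) + ∑[ j < M ] row (a ↑ˡ M) (n ↑ʳ j)
    ≡⟨ cong₂ _+_ (sum-cong-≗ (λ b → cong b2n (padded-↑ˡ G M a b))) (sum-cong-≗ new) ⟩
  ∑[ b < n ] b2n (adj G a b) + ∑[ j < M ] 0               ≡⟨ cong (_ +_) (sum-replicate-zero M) ⟩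
  ∑[ b < n ] b2n (adj G a b) + 0                          ≡⟨ +-identityʳ _ ⟩
  ∑[ b < n ] b2n (adj G a b)                              ≡⟨ degree≡∑ G a ⟨
  degree G a                                              ∎
  where
  open ≡-Reasoning
  P = padded G M
  row : Fin (n + M) → Fin (n + M) → ℕ
  row x z = b2n (adj P x z)
  new : ∀ j → row (a ↑ˡ M) (n ↑ʳ j) ≡ 0
  new j rewrite splitAt-↑ˡ n a M | splitAt-↑ʳ n M j = refl

degree-padded-↑ʳ : ∀ {n} (G : Graph n) M (j : Fin M) → degree (padded G M) (n ↑ʳ j) ≡ 0
degree-padded-↑ʳ {n} G M j = trans (degree≡∑ (padded G M) (n ↑ʳ j))
  (trans (sum-cong-≗ isolated) (sum-replicate-zero (n + M)))
  where
  isolated : ∀ z → b2n (adj (padded G M) (n ↑ʳ j) z) ≡ 0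
  isolated z rewrite splitAt-↑ʳ n M j = refl

padded-bounded : ∀ {n d} (G : Graph n) M → MaxDegreeAtMost G d → MaxDegreeAtMost (padded G M) d
padded-bounded {n} {d} G M bounded x =
  subst (λ y → degree (padded G M) y ≤ d) (join-splitAt n M x) (byPart (splitAt n x))
  where
  byPart : ∀ s → degree (padded G M) (join n M s) ≤ d
  byPart (inj₁ a) = subst (_≤ d) (sym (degree-padded-↑ˡ G M a)) (bounded a)
  byPart (inj₂ j) = subst (_≤ d) (sym (degree-padded-↑ʳ G M j)) z≤n

-- Growing G to a d-regular graph

module Completion {n M d : ℕ} (G : Graph n) (d<M : d < M) (even : 2 ∣ (n + M) * d) where

  Contains : Graph (n + M) → Set
  Contains F = ∀ a b → adj G a b ≡ true → adj F (a ↑ˡ M) (b ↑ˡ M) ≡ true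

  record Extension : Set where
    field
      graph    : Graph (n + M)
      contains : Contains graph
      bounded  : MaxDegreeAtMost graph d

  total : Extension → ℕ
  total E = ∑[ x < n + M ] degree (Extension.graph E) x

  Augmentation : Extension → Set
  Augmentation E = Σ[ E′ ∈ Extension ] total E′ ≡ total E + 2

  Saturated : Extension → Fin (n + M) → Set
  Saturated E u = let open Extension E in
    ∀ x → u ≢ x → degree graph x < d → adj graph u x ≡ true

  module _ (E : Extension) where
    open Extension E renaming (graph to F)

    deficient⇒total< : ∀ {u} → degree F u < d → total E < (n + M) * d
    deficient⇒total< {u} u<d = begin-strict
      total E                              <⟨ m<m+n (total E) z<s ⟩
      total E + 1                          ≡⟨ ∑-+δ (degree F) u ⟨
      ∑[ x < n + M ] (degree F x + δ u x)  ≤⟨ ∑-mono-≤ (+δ-≤ bounded u<d) ⟩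
      ∑[ x < n + M ] d                     ≡⟨ ∑-const (n + M) d ⟩
      (n + M) * d                          ∎
      where open ≤-Reasoning

    grow : (H : Graph (n + M)) {u v : Fin (n + M)} → Contains H →
           (∀ x → degree H x ≡ degree F x + δ u x + δ v x) →
           degree F u < d → degree F v + δ u v < d → Augmentation E
    grow H {u} {v} contains′ degree-H u<d v<d =
      record { graph = H ; contains = contains′ ; bounded = bounded′ } , (begin
        ∑[ x < n + M ] degree H x                    ≡⟨ sum-cong-≗ degree-H ⟩
        ∑[ x < n + M ] (degree F x + δ u x + δ v x)  ≡⟨ ∑-+δ _ v ⟩
        ∑[ x < n + M ] (degree F x + δ u x) + 1      ≡⟨ cong (_+ 1) (∑-+δ (degree F) u) ⟩
        total E + 1 + 1                              ≡⟨ +-assoc (total E) 1 1 ⟩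
        total E + 2                                  ∎)
      where
      open ≡-Reasoning
      bounded′ : MaxDegreeAtMost H d
      bounded′ x = subst (_≤ d) (sym (degree-H x)) (+δ-≤ (+δ-≤ bounded u<d) v<d x)

    deficient+δ : ∀ {u v} → u ≢ v → degree F v < d → degree F v + δ u v < d
    deficient+δ u≢v v<d = subst (_< d) (sym (trans (cong (_ +_) (δ-≢ u≢v)) (+-identityʳ _))) v<d

    addEdgeStep : ∀ {u x} (u≢x : u ≢ x) → adj F u x ≡ false →
                  degree F u < d → degree F x < d → Augmentation E
    addEdgeStep u≢x ¬ux u<d x<d =
      grow (setEdge F _ _ u≢x true) (λ a b ab → setEdge-true-⊇ F u≢x (contains a b ab))
        (degree-addEdge F u≢x ¬ux) u<d (deficient+δ u≢x x<d)

    switchStep : ∀ {u v} → v ≡ u ⊎ adj F u v ≡ true → degree F u < d →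
                 degree F v + δ u v < d → Saturated E u → Augmentation E
    switchStep {u} {v} v∈N[u] u<d v<d saturated
      with freshNonNeighbour F u (≤-<-trans (subst (_≤ d) (+-comm 1 _) u<d) d<M)
    ... | j , u≢w , ¬uw
      with privateNeighbour F v∈N[u] ¬uw (<-≤-trans (m+n≤o⇒m≤o (suc (degree F v)) v<d) w-full)
      where
      w-full : d ≤ degree F (n ↑ʳ j)
      w-full = ≮⇒≥ (λ w<d → true≢false (trans (sym (saturated _ u≢w w<d)) ¬uw))
    ... | y , wy , v≢y , ¬vy =
      grow (switch F w≢y w≢u v≢y)
        (λ a b ab → switch-⊇ F w≢y w≢u v≢y (↑ʳ≢↑ˡ j a) (↑ʳ≢↑ˡ j b) (contains a b ab))
        (degree-switch F w≢y w≢u v≢y (nonNeighbour≢neighbour F v∈N[u] u≢w ¬uw)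
                       wy (trans (symmetric F w u) ¬uw) ¬vy)
        u<d v<d
      where
      w = n ↑ʳ j
      w≢u : w ≢ u
      w≢u = u≢w ∘ sym
      w≢y : w ≢ y
      w≢y = adj⇒≢ F wy

    -- Otherwise the degree sum would be (n + M) d − 1, which is odd.
    noLonelyDeficit : ∀ {u} → degree F u < d → ¬ degree F u + 1 < d →
                      (∀ v → u ≢ v → ¬ degree F v < d) → ⊥
    noLonelyDeficit {u} u<d ¬u+1<d others-full =
      2∤1 (∣m+n∣m⇒∣n (subst (2 ∣_) (sym total+1≡) even) (handshake F))
      where
      exact : ∀ x → degree F x + δ u x ≡ d
      exact x with u ≟ x
      ... | yes refl = ≤-antisym (subst (_≤ d) (+-comm 1 _) u<d) (≮⇒≥ ¬u+1<d)
      ... | no  u≢x  = trans (+-identityʳ _) (≤-antisym (bounded x) (≮⇒≥ (others-full x u≢x)))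
      total+1≡ : total E + 1 ≡ (n + M) * d
      total+1≡ = trans (sym (∑-+δ (degree F) u)) (trans (sum-cong-≗ exact) (∑-const (n + M) d))
      2∤1 : ¬ 2 ∣ 1
      2∤1 2∣1 with ∣1⇒≡1 2∣1
      ... | ()

    augmentSaturated : ∀ {u} → degree F u < d → Saturated E u → Augmentation E
    augmentSaturated {u} u<d saturated with degree F u + 1 <? d
    ... | yes u+1<d =
      switchStep (inj₁ refl) u<d (subst (λ t → degree F u + t < d) (sym (δ-refl u)) u+1<d) saturated
    ... | no ¬u+1<d with any? (λ v → ¬? (u ≟ v) ×-dec (degree F v <? d))
    ...   | yes (v , u≢v , v<d) =
      switchStep (inj₂ (saturated v u≢v v<d)) u<d (deficient+δ u≢v v<d) saturated
    ...   | no none = ⊥-elim (noLonelyDeficit u<d ¬u+1<d (λ v u≢v v<d → none (v , u≢v , v<d)))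

    augment : ∀ {u} → degree F u < d → Augmentation E
    augment {u} u<d
      with any? (λ x → ¬? (u ≟ x) ×-dec (adj F u x Bool.≟ false) ×-dec (degree F x <? d))
    ... | yes (x , u≢x , ¬ux , x<d) = addEdgeStep u≢x ¬ux u<d x<d
    ... | no none = augmentSaturated u<d saturated
      where
      saturated : Saturated E u
      saturated x u≢x x<d with adj F u x in ux
      ... | true  = refl
      ... | false = ⊥-elim (none (x , u≢x , ux , x<d))

  complete : (fuel : ℕ) (E : Extension) → (n + M) * d ≤ total E + fuel →
             Σ[ H ∈ Graph (n + M) ] (Regular H d × Contains H)
  complete fuel E enough with any? (λ u → degree (Extension.graph E) u <? d)
  ... | no none = graph , (λ x → ≤-antisym (bounded x) (≮⇒≥ (λ x<d → none (x , x<d)))) , contains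
    where open Extension E
  complete zero E enough | yes (u , u<d) =
    ⊥-elim (<⇒≱ (deficient⇒total< E u<d) (subst ((n + M) * d ≤_) (+-identityʳ (total E)) enough))
  complete (suc fuel) E enough | yes (u , u<d) with augment E u<d
  ... | E′ , grew = complete fuel E′ (begin
    (n + M) * d          ≤⟨ enough ⟩
    total E + suc fuel   ≤⟨ +-monoʳ-≤ (total E) (n≤1+n (suc fuel)) ⟩
    total E + (2 + fuel) ≡⟨ +-assoc (total E) 2 fuel ⟨
    total E + 2 + fuel   ≡⟨ cong (_+ fuel) grew ⟨
    total E′ + fuel      ∎)
    where open ≤-Reasoning

  completion : MaxDegreeAtMost G d → Σ[ H ∈ Graph (n + M) ] (Regular H d × Contains H)
  completion bounded = complete ((n + M) * d) initial (m≤n+m _ _)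
    where
    initial : Extension
    initial = record { graph = padded G M ; contains = λ a b ab → trans (padded-↑ˡ G M a b) ab
                     ; bounded = padded-bounded G M bounded }

lemma22 : (n d N : ℕ) (G : Graph n) → MaxDegreeAtMost G d → n + d + 1 ≤ N → 2 ∣ N * d → Σ[ H ∈ Graph N ] (Regular H d × SubgraphOf G H)
lemma22 n d N G bounded n+d+1≤N even
  with m≤n⇒∃[o]m+o≡n (m+n≤o⇒m≤o n (subst (_≤ N) (+-assoc n d 1) n+d+1≤N))
... | M , refl with Completion.completion G d<M even bounded
  where
  d<M : d < M
  d<M = +-cancelˡ-≤ n (suc d) M
          (subst (_≤ n + M) (trans (+-assoc n d 1) (cong (n +_) (+-comm d 1))) n+d+1≤N)
... | H , regular , contains = H , regular , record
  { embed = _↑ˡ M ; injective = ↑ˡ-injective M _ _ ; preserves = contains }
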